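{- Let $\phi$ be a CNF formula, let $\{X,Y\}$ be a partition of $\mathrm{vars}(\phi)$, let $(T,r,\gamma,\pi)$ be an $(X,Y)$-graded project-join tree for $\phi$ with grades $\mathcal{I}_X,\mathcal{I}_Y$, and let $\mathrm{pr}:Y\to[0,1]$ be a probability mapping. Then for every node $v$ of $T$, $$\mathrm{val}(v)=\exists_{\Pi(v)\cap X}\,\mathcal{R}^{\mathrm{pr}}_{\Pi(v)\cap Y}\prod_{c\in\Gamma(v)}[c].$$
   Context: Variables are binary and $2^S$ is the set of truth assignments $S\to\{0,1\}$. Pseudo-Boolean functions are maps $2^X\to\mathbb{R}$. Join: $(f\cdot g)(\tau)=f(\tau|_X)g(\tau|_Y)$. Existential projection: $(\exists_x f)(\tau)=\max(f(\tau\cup\{x\mapsto0\}),f(\tau\cup\{x\mapsto1\}))$. Random projection: $(\mathcal{R}^p_x f)(\tau)=p f(\tau\cup\{x\mapsto1\})+(1-p)f(\tau\cup\{x\mapsto0\})$. $\exists_S$ and $\mathcal{R}^{\mathrm{pr}}_S$ apply the respective projection for all $x\in S$, using $\mathrm{pr}(x)$ for $\mathcal{R}$. Both are order-independent and are the identity on $\emptyset$. A CNF formula is a set of clauses; $[c]$ is the 0/1-valued function of a clause $c$. A project-join tree for $\phi$ is $(T,r,\gamma,\pi)$ where: - $(T,r)$ is a rooted tree with children sets $C(v)$, where leaves are non-root degree-one nodes and the other nodes are internal; - $\gamma$ is a bijection from the leaves to the clauses; - $\pi$ maps internal nodes to subsets of $\mathrm{vars}(\phi)$; - $\{\pi(v)\}$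 partitions $\mathrm{vars}(\phi)$, where some $\pi(v)$ may be empty; - for internal $v$, $x\in\pi(v)$ and a clause $c$ containing $x$, the leaf $\gamma^{ -1}(c)$ is a descendant of $v$. $(X,Y)$-graded with grades $\mathcal{I}_X,\mathcal{I}_Y$ means: - $\{\mathcal{I}_X,\mathcal{I}_Y\}$ partitions the internal nodes; - $\pi(v)\subseteq X$ on $\mathcal{I}_X$; - $\pi(v)\subseteq Y$ on $\mathcal{I}_Y$; - no node of $\mathcal{I}_X$ is a descendant of a node of $\mathcal{I}_Y$. Valuation: - $\mathrm{val}(v)=[\gamma(v)]$ for a leaf; - $\mathrm{val}(v)=\exists_{\pi(v)}\prod_{v'\in C(v)}\mathrm{val}(v')$ for $v\in\mathcal{I}_X$; - $\mathrm{val}(v)=\mathcal{R}^{\mathrm{pr}}_{\pi(v)}\prod_{v'\in C(v)}\mathrm{val}(v')$ for $v\in\mathcal{I}_Y$. Projection set: $\Pi(v)=\emptyset$ for a leaf, and $\Pi(v)=\pi(v)\cup\bigcup_{v'\in C(v)}\Pi(v')$ otherwise. Clause set: $\Gamma(v)=\{\gamma(v)\}$ for a leaf, and $\Gamma(v)=\bigcup_{v'\in C(v)}\Gamma(v')$ otherwise.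
   Formalization: The probability mapping pr takes rational values in [0,1], and pseudo-Boolean functions take values in ℚ instead of ℝ. -}

module Defs where

open import Data.Bool using (Bool; true; false; if_then_else_)
open import Data.Nat using (ℕ; _≡ᵇ_)
import Data.Nat as N
open import Data.Fin using (Fin)
open import Data.List using (List; []; _∷_; foldr; map; filter; _++_; allFin)
open import Data.Bool.ListAction using (any)
open import Data.List.Relation.Unary.Any using (Any)
open import Data.List.Membership.Propositional using (_∈_)
open import Data.List.Membership.DecPropositional N._≟_ using (_∈?_)
open import Data.List.Relation.Binary.Permutation.Propositional using (_↭_)
open import Data.Product using (Σ; _×_; _,_; proj₁)
open import Data.Sum using (_⊎_)
open import Data.Empty using (⊥)
open import Relation.Binary.PropositionalEquality using (_≡_)
open import Relation.Nullary.Decidable using (⌊_⌋)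
open import Data.Rational using (ℚ; 0ℚ; 1ℚ; _*_; _+_; _-_; _⊔_; _≤_)

Var : Set
Var = ℕ

-- A (total) truth assignment.  A pseudo-Boolean function on 2^S is
-- represented by a function on total assignments (which in our use only
-- depends on the variables of S).
Assignment : Set
Assignment = Var → Bool

PBF : Set
PBF = Assignment → ℚ

upd : Assignment → Var → Bool → Assignment
upd τ x b y = if y ≡ᵇ x then b else τ y

_·_ : PBF → PBF → PBF
(f · g) τ = f τ * g τ

one : PBF
one _ = 1ℚ

∃₁ : Var → PBF → PBF
∃₁ x f τ = f (upd τ x false) ⊔ f (upd τ x true)

R₁ : ℚ → Var → PBF → PBF
R₁ p x f τ = p * f (upd τ x true) + (1ℚ - p) * f (upd τ x false)

∃[_] : List Var → PBF → PBF
∃[ S ] f = foldr ∃₁ f S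

R[_,_] : (Var → ℚ) → List Var → PBF → PBF
R[ pr , S ] f = foldr (λ x g → R₁ (pr x) x g) f S

Literal : Set
Literal = Var × Bool          -- (x , true) is x, (x , false) is ¬x

Clause : Set
Clause = List Literal

CNF : ℕ → Set
CNF m = Fin m → Clause

litSat : Assignment → Literal → Bool
litSat τ (x , b) = if τ x then b else (if b then false else true)

⟦_⟧ : Clause → PBF
⟦ c ⟧ τ = if any (litSat τ) c then 1ℚ else 0ℚ

clauseVars : Clause → List Var
clauseVars = map proj₁

VarOf : ∀ {m} → CNF m → Var → Set
VarOf {m} φ x = Σ (Fin m) λ i → x ∈ clauseVars (φ i)

data Grade : Set where
  gX gY : Grade

-- leaves carry the index of their clause (γ); internal nodes carry their
-- grade, π(v) and the list of children C(v)
data Tree (m : ℕ) : Set where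
  leaf : Fin m → Tree m
  node : Grade → List Var → List (Tree m) → Tree m

children : ∀ {m} → Tree m → List (Tree m)
children (leaf _)      = []
children (node _ _ cs) = cs

-- s ⊑ t : s is (the subtree rooted at) a node of t (a descendant of t, or t)
data _⊑_ {m : ℕ} (s : Tree m) : Tree m → Set where
  here  : s ⊑ s
  there : ∀ {g π cs} → Any (s ⊑_) cs → s ⊑ node g π cs

-- leaf labels below a node: the clause set Γ(v) (as clause indices)
mutual
  leaves : ∀ {m} → Tree m → List (Fin m)
  leaves (leaf i)      = i ∷ []
  leaves (node _ _ cs) = leavesL cs

  leavesL : ∀ {m} → List (Tree m) → List (Fin m)
  leavesL []       = []
  leavesL (c ∷ cs) = leaves c ++ leavesL cs

mutual
  Πset : ∀ {m} → Tree m → List Var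
  Πset (leaf _)      = []
  Πset (node _ π cs) = π ++ ΠsetL cs

  ΠsetL : ∀ {m} → List (Tree m) → List Var
  ΠsetL []       = []
  ΠsetL (c ∷ cs) = Πset c ++ ΠsetL cs

mutual
  occ : ∀ {m} → Var → Tree m → ℕ
  occ x (leaf _)      = 0
  occ x (node _ π cs) = (if ⌊ x ∈? π ⌋ then 1 else 0) N.+ occL x cs

  occL : ∀ {m} → Var → List (Tree m) → ℕ
  occL x []       = 0
  occL x (c ∷ cs) = occ x c N.+ occL x cs

prodClauses : ∀ {m} → CNF m → List (Fin m) → PBF
prodClauses φ []       = one
prodClauses φ (i ∷ is) = ⟦ φ i ⟧ · prodClauses φ is

mutual
  val : ∀ {m} → CNF m → (Var → ℚ) → Tree m → PBF
  val φ pr (leaf i)       = ⟦ φ i ⟧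
  val φ pr (node gX π cs) = ∃[ π ] (valL φ pr cs)
  val φ pr (node gY π cs) = R[ pr , π ] (valL φ pr cs)

  valL : ∀ {m} → CNF m → (Var → ℚ) → List (Tree m) → PBF
  valL φ pr []       = one
  valL φ pr (c ∷ cs) = val φ pr c · valL φ pr cs

_∩_ : List Var → List Var → List Var
S ∩ Z = filter (_∈? Z) S

gradeSet : List Var → List Var → Grade → List Var
gradeSet X Y gX = X
gradeSet X Y gY = Y

record IsProjectJoinTree {m : ℕ} (φ : CNF m) (T : Tree m) : Set where
  field
    -- non-root nodes of degree one are exactly the leaves:
    -- no non-root internal node is childless
    nonRootInternal : ∀ v g π → v ⊑ T → node g π [] ∈ children v → ⊥
    -- γ is a bijection from the leaves to the clauses
    γ-bij : leaves T ↭ allFin m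
    -- {π(v)} partitions vars(φ) (empty blocks allowed)
    π-partition : ∀ x → (VarOf φ x → occ x T ≡ 1) × ((VarOf φ x → ⊥) → occ x T ≡ 0)
    π-scope : ∀ g π cs → node g π cs ⊑ T → ∀ x → x ∈ π →
              ∀ i → x ∈ clauseVars (φ i) → i ∈ leaves (node g π cs)

-- ... which is moreover (X,Y)-graded (grades given by the node tags)
record IsGraded {m : ℕ} (X Y : List Var) (T : Tree m) : Set where
  field
    π⊆grade : ∀ g π cs → node g π cs ⊑ T → ∀ x → x ∈ π → x ∈ gradeSet X Y g
    X-not-below-Y : ∀ π cs π′ cs′ → node gY π cs ⊑ T →
                    node gX π′ cs′ ⊑ node gY π cs → ⊥

IsVarPartition : ∀ {m} → CNF m → List Var → List Var → Set
IsVarPartition φ X Y =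
  ∀ x → (VarOf φ x → x ∈ X ⊎ x ∈ Y) × (x ∈ X ⊎ x ∈ Y → VarOf φ x) × (x ∈ X → x ∈ Y → ⊥)

IsProbMap : List Var → (Var → ℚ) → Set
IsProbMap Y pr = ∀ y → y ∈ Y → (0ℚ ≤ pr y) × (pr y ≤ 1ℚ)

{-# OPTIONS --safe #-}
-- Maximum and p-weighted averaging are positively homogeneous, so
-- projecting a variable commutes with multiplication by a nonnegative factor that does not
-- depend on it. Since every clause labels exactly one leaf and a variable projected at a node
-- occurs only in clauses below that node, the variables projected inside one child occur in no
-- clause below its siblings; hence the product of the children's values is the graded
-- projection of the product of their clauses. At an X-node π(v) ⊆ X joins the existential
-- block; below a Y-node every projected variable lies in Y, so π(v) joins the random block.
module Submission where

open import Defs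
open import Data.Nat using (ℕ; _≡ᵇ_)
open import Data.List using (List)
open import Data.Rational using (ℚ)
open import Relation.Binary.PropositionalEquality using (_≡_)

open import Level using (0ℓ)
open import Function using (_∘_)
open import Data.Bool using (true; false; if_then_else_)
open import Data.Bool.ListAction using (any; or)
import Data.Bool as Bool
open import Data.Unit using (tt)
open import Data.Nat.Properties using (≡ᵇ⇒≡)
open import Data.Fin using (Fin)
open import Data.List using ([]; _∷_; foldr; _++_)
open import Data.List.Properties
  using (foldr-++; filter-++; filter-all; filter-none; map-cong-local)
open import Data.List.Relation.Unary.Any using (Any; here; there)
import Data.List.Relation.Unary.Any as Any
open import Data.List.Relation.Unary.All using (All; []; _∷_)
import Data.List.Relation.Unary.All as All
open import Data.List.Relation.Unary.All.Properties using (++⁻ˡ; ++⁻ʳ; all-filter; filter⁺)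
open import Data.List.Membership.Propositional using (_∈_; _∉_; find)
open import Data.List.Membership.Propositional.Properties
  using (∈-++⁺ˡ; ∈-++⁺ʳ; ∈-++⁻; ∈-map⁺)
open import Data.List.Membership.DecPropositional Data.Nat._≟_ using (_∈?_)
open import Data.List.Relation.Unary.Unique.Propositional using (Unique; []; _∷_)
open import Data.List.Relation.Unary.Unique.Propositional.Properties using (allFin⁺)
open import Data.List.Relation.Binary.Disjoint.Propositional using (Disjoint)
import Data.List.Relation.Binary.Disjoint.Propositional.Properties as Disjoint
open import Data.List.Relation.Binary.Permutation.Propositional using (↭-sym; ↭⇒↭ₛ)
open import Data.List.Relation.Binary.Permutation.Setoid.Properties using (Unique-resp-↭)
open import Data.Product using (_,_; proj₁; proj₂)
open import Data.Sum using (inj₁; inj₂)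
open import Data.Empty using (⊥-elim)
open import Relation.Unary using (Pred; ∁)
open import Relation.Binary.PropositionalEquality
  using (_≗_; setoid; refl; sym; trans; cong; cong₂; cong-app; subst; module ≡-Reasoning)
open import Data.Rational using (0ℚ; 1ℚ; _*_; _+_; _-_; -_; _⊔_; _≤_; nonNegative)
import Data.Rational.Properties as ℚ

Agree : Pred Var 0ℓ → Assignment → Assignment → Set
Agree D τ τ′ = ∀ y → D y → τ y ≡ τ′ y

DependsOnlyOn : Pred Var 0ℓ → PBF → Set
DependsOnlyOn D f = ∀ τ τ′ → Agree D τ τ′ → f τ ≡ f τ′

NonNegative : PBF → Set
NonNegative f = ∀ τ → 0ℚ ≤ f τ

upd-agree : ∀ {D τ τ′} x b → Agree D τ τ′ → Agree D (upd τ x b) (upd τ′ x b)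
upd-agree x b agree y y∈D with y ≡ᵇ x
... | true  = refl
... | false = agree y y∈D

upd-outside : ∀ {D} τ {x} b → ∁ D x → Agree D (upd τ x b) τ
upd-outside {D} τ {x} b x∉D y y∈D with y ≡ᵇ x in y≡ᵇx
... | true  = ⊥-elim (x∉D (subst D (≡ᵇ⇒≡ y x (subst Bool.T (sym y≡ᵇx) tt)) y∈D))
... | false = refl

*-nonNeg : ∀ {p q} → 0ℚ ≤ p → 0ℚ ≤ q → 0ℚ ≤ p * q
*-nonNeg {p} {q} 0≤p 0≤q =
  subst (_≤ p * q) (ℚ.*-zeroˡ q) (ℚ.*-monoʳ-≤-nonNeg q {{nonNegative 0≤q}} 0≤p)

project : (ℚ → ℚ → ℚ) → Var → PBF → PBF
project o x f τ = o (f (upd τ x false)) (f (upd τ x true))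

projectAll : (Var → ℚ → ℚ → ℚ) → List Var → PBF → PBF
projectAll o S f = foldr (λ x → project (o x) x) f S

-- Up to unfolding, ∃[ S ] is projectAll maxOp S and R[ pr , S ] is projectAll (expectOp pr) S.
maxOp : Var → ℚ → ℚ → ℚ
maxOp _ = _⊔_

expectOp : (Var → ℚ) → Var → ℚ → ℚ → ℚ
expectOp pr x a b = pr x * b + (1ℚ - pr x) * a

record IsPosHomogeneous (o : ℚ → ℚ → ℚ) : Set where
  field
    homogeneous      : ∀ a b {c} → 0ℚ ≤ c → o (a * c) (b * c) ≡ o a b * c
    preserves-nonNeg : ∀ {a b} → 0ℚ ≤ a → 0ℚ ≤ b → 0ℚ ≤ o a b

open IsPosHomogeneous

⊔-isPosHomogeneous : IsPosHomogeneous _⊔_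
⊔-isPosHomogeneous = record
  { homogeneous      = λ a b {c} 0≤c →
      sym (ℚ.mono-≤-distrib-⊔ (ℚ.*-monoʳ-≤-nonNeg c {{nonNegative 0≤c}}) a b)
  ; preserves-nonNeg = λ 0≤a _ → ℚ.≤-trans 0≤a (ℚ.p≤p⊔q _ _)
  }

convex-isPosHomogeneous : ∀ {p} → 0ℚ ≤ p → p ≤ 1ℚ →
                          IsPosHomogeneous (λ a b → p * b + (1ℚ - p) * a)
convex-isPosHomogeneous {p} 0≤p p≤1 = record
  { homogeneous      = λ a b {c} _ → sym (trans (ℚ.*-distribʳ-+ c (p * b) (q * a))
                                            (cong₂ _+_ (ℚ.*-assoc p b c) (ℚ.*-assoc q a c)))
  ; preserves-nonNeg = λ {a} {b} 0≤a 0≤b → subst (_≤ p * b + q * a) (ℚ.+-identityʳ 0ℚ)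
                                         (ℚ.+-mono-≤ (*-nonNeg 0≤p 0≤b) (*-nonNeg 0≤q 0≤a))
  }
  where
  q = 1ℚ - p
  0≤q : 0ℚ ≤ q
  0≤q = subst (_≤ q) (ℚ.+-inverseʳ p) (ℚ.+-monoˡ-≤ (- p) p≤1)

module _ (o : Var → ℚ → ℚ → ℚ) where

  projectAll-cong : ∀ S {f g} → f ≗ g → projectAll o S f ≗ projectAll o S g
  projectAll-cong []      f≗g = f≗g
  projectAll-cong (x ∷ S) f≗g τ = cong₂ (o x) (projectAll-cong S f≗g _) (projectAll-cong S f≗g _)

  projectAll-++ : ∀ S S′ f → projectAll o (S ++ S′) f ≗ projectAll o S (projectAll o S′ f)
  projectAll-++ S S′ f = cong-app (foldr-++ (λ x → project (o x) x) f S S′)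

  projectAll-dependsOnlyOn : ∀ S {D f} → DependsOnlyOn D f → DependsOnlyOn D (projectAll o S f)
  projectAll-dependsOnlyOn []      dep = dep
  projectAll-dependsOnlyOn (x ∷ S) {f = f} dep τ τ′ agree =
    cong₂ (o x) (below false) (below true)
    where
    below : ∀ b → projectAll o S f (upd τ x b) ≡ projectAll o S f (upd τ′ x b)
    below b = projectAll-dependsOnlyOn S dep (upd τ x b) (upd τ′ x b) (upd-agree x b agree)

  projectAll-nonNeg : ∀ {S f} → All (IsPosHomogeneous ∘ o) S → NonNegative f →
                      NonNegative (projectAll o S f)
  projectAll-nonNeg []         f≥0 = f≥0
  projectAll-nonNeg (hom ∷ hs) f≥0 τ =
    preserves-nonNeg hom (projectAll-nonNeg hs f≥0 _) (projectAll-nonNeg hs f≥0 _)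

  projectAll-·ʳ : ∀ {S D f g} → All (IsPosHomogeneous ∘ o) S → All (∁ D) S →
                  DependsOnlyOn D g → NonNegative g →
                  projectAll o S (f · g) ≗ projectAll o S f · g
  projectAll-·ʳ []                        _               _   _   τ = refl
  projectAll-·ʳ {x ∷ S} {f = f} {g} (hom ∷ hs) (x∉D ∷ S∉D) dep g≥0 τ = begin
    o x (projectAll o S (f · g) (upd τ x false)) (projectAll o S (f · g) (upd τ x true))
      ≡⟨ cong₂ (o x) (pull false) (pull true) ⟩
    o x (F (upd τ x false) * g τ) (F (upd τ x true) * g τ)
      ≡⟨ homogeneous hom _ _ (g≥0 τ) ⟩
    o x (F (upd τ x false)) (F (upd τ x true)) * g τ ∎
    where
    open ≡-Reasoning
    F = projectAll o S f
    pull : ∀ b → projectAll o S (f · g) (upd τ x b) ≡ F (upd τ x b) * g τ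
    pull b = trans (projectAll-·ʳ hs S∉D dep g≥0 (upd τ x b))
                   (cong (F (upd τ x b) *_) (dep _ _ (upd-outside τ b x∉D)))

  projectAll-·ˡ : ∀ {S D f g} → All (IsPosHomogeneous ∘ o) S → All (∁ D) S →
                  DependsOnlyOn D g → NonNegative g →
                  projectAll o S (g · f) ≗ g · projectAll o S f
  projectAll-·ˡ {S} {f = f} {g} hs S∉D dep g≥0 τ =
    trans (projectAll-cong S (λ τ′ → ℚ.*-comm (g τ′) (f τ′)) τ)
          (trans (projectAll-·ʳ hs S∉D dep g≥0 τ) (ℚ.*-comm _ (g τ)))

  projectAll-·-projectAll :
    ∀ {S S′ Df Dg f g} → All (IsPosHomogeneous ∘ o) S → All (IsPosHomogeneous ∘ o) S′ →
    All (∁ Dg) S → All (∁ Df) S′ →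
    DependsOnlyOn Df f → DependsOnlyOn Dg g → NonNegative f → NonNegative g →
    projectAll o S f · projectAll o S′ g ≗ projectAll o S (projectAll o S′ (f · g))
  projectAll-·-projectAll {S} {S′} hs hs′ S∉Dg S′∉Df depf depg f≥0 g≥0 τ =
    trans (sym (projectAll-·ʳ hs S∉Dg (projectAll-dependsOnlyOn S′ depg)
                              (projectAll-nonNeg hs′ g≥0) τ))
          (projectAll-cong S (λ τ′ → sym (projectAll-·ˡ hs′ S′∉Df depf f≥0 τ′)) τ)

module GradedProjection (X Y : List Var) (pr : Var → ℚ) where

  gradedProject : List Var → PBF → PBF
  gradedProject S f = ∃[ S ∩ X ] (R[ pr , S ∩ Y ] f)

  gradedProject-cong : ∀ S {f g} → f ≗ g → gradedProject S f ≗ gradedProject S g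
  gradedProject-cong S f≗g =
    projectAll-cong maxOp (S ∩ X) (projectAll-cong (expectOp pr) (S ∩ Y) f≗g)

  private
    ∩-++ : ∀ S S′ Z → (S ++ S′) ∩ Z ≡ S ∩ Z ++ S′ ∩ Z
    ∩-++ S S′ Z = filter-++ (_∈? Z) S S′

    ∩-⊆ : ∀ {S Z} → All (_∈ Z) S → S ∩ Z ≡ S
    ∩-⊆ {Z = Z} = filter-all (_∈? Z)

    ∩-disjoint : ∀ {S Z} → All (_∉ Z) S → S ∩ Z ≡ []
    ∩-disjoint {Z = Z} = filter-none (_∈? Z)

    ∃R-cong : ∀ {A A′ B B′} f → A ≡ A′ → B ≡ B′ →
              ∃[ A ] (R[ pr , B ] f) ≗ ∃[ A′ ] (R[ pr , B′ ] f)
    ∃R-cong f refl refl τ = refl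

  open ≡-Reasoning

  ∃-gradedProject : ∀ {π S} f → All (_∈ X) π → All (_∉ Y) π →
                    ∃[ π ] (gradedProject S f) ≗ gradedProject (π ++ S) f
  ∃-gradedProject {π} {S} f π⊆X π∩Y=∅ τ = begin
    ∃[ π ] (∃[ S ∩ X ] (R[ pr , S ∩ Y ] f)) τ    ≡⟨ projectAll-++ maxOp π (S ∩ X) _ τ ⟨
    ∃[ π ++ S ∩ X ] (R[ pr , S ∩ Y ] f) τ        ≡⟨ ∃R-cong f π++S∩X π++S∩Y τ ⟨
    gradedProject (π ++ S) f τ ∎
    where
    π++S∩X : (π ++ S) ∩ X ≡ π ++ S ∩ X
    π++S∩X = trans (∩-++ π S X) (cong (_++ S ∩ X) (∩-⊆ π⊆X))
    π++S∩Y : (π ++ S) ∩ Y ≡ S ∩ Y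
    π++S∩Y = trans (∩-++ π S Y) (cong (_++ S ∩ Y) (∩-disjoint π∩Y=∅))

  R-gradedProject : ∀ {π S} f → All (_∉ X) (π ++ S) → All (_∈ Y) (π ++ S) →
                    R[ pr , π ] (gradedProject S f) ≗ gradedProject (π ++ S) f
  R-gradedProject {π} {S} f π++S∩X=∅ π++S⊆Y τ = begin
    R[ pr , π ] (∃[ S ∩ X ] (R[ pr , S ∩ Y ] f)) τ
      ≡⟨ projectAll-cong (expectOp pr) π
           (∃R-cong f (∩-disjoint (++⁻ʳ π π++S∩X=∅)) (∩-⊆ (++⁻ʳ π π++S⊆Y))) τ ⟩
    R[ pr , π ] (R[ pr , S ] f) τ        ≡⟨ projectAll-++ (expectOp pr) π S f τ ⟨
    R[ pr , π ++ S ] f τ                 ≡⟨ ∃R-cong f (∩-disjoint π++S∩X=∅) (∩-⊆ π++S⊆Y) τ ⟨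
    gradedProject (π ++ S) f τ ∎

  gradedProject-· :
    ∀ {S S′ Df Dg f g} → IsProbMap Y pr → All (∁ Dg) S → All (∁ Df) S′ →
    DependsOnlyOn Df f → DependsOnlyOn Dg g → NonNegative f → NonNegative g →
    gradedProject S f · gradedProject S′ g ≗ gradedProject (S ++ S′) (f · g)
  gradedProject-· {S} {S′} {f = f} {g} prob S∉Dg S′∉Df depf depg f≥0 g≥0 τ = begin
    (gradedProject S f · gradedProject S′ g) τ
      ≡⟨ projectAll-·-projectAll maxOp (maxHom _) (maxHom _) (∩⁺ S∉Dg) (∩⁺ S′∉Df)
           (projectAll-dependsOnlyOn (expectOp pr) (S ∩ Y) depf)
           (projectAll-dependsOnlyOn (expectOp pr) (S′ ∩ Y) depg)
           (projectAll-nonNeg (expectOp pr) (expectHom S) f≥0)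
           (projectAll-nonNeg (expectOp pr) (expectHom S′) g≥0) τ ⟩
    ∃[ S ∩ X ] (∃[ S′ ∩ X ] (R[ pr , S ∩ Y ] f · R[ pr , S′ ∩ Y ] g)) τ
      ≡⟨ projectAll-cong maxOp (S ∩ X) (projectAll-cong maxOp (S′ ∩ X)
           (projectAll-·-projectAll (expectOp pr) (expectHom S) (expectHom S′) (∩⁺ S∉Dg) (∩⁺ S′∉Df)
              depf depg f≥0 g≥0)) τ ⟩
    ∃[ S ∩ X ] (∃[ S′ ∩ X ] (R[ pr , S ∩ Y ] (R[ pr , S′ ∩ Y ] (f · g)))) τ
      ≡⟨ projectAll-cong maxOp (S ∩ X) (projectAll-cong maxOp (S′ ∩ X)
           (projectAll-++ (expectOp pr) (S ∩ Y) (S′ ∩ Y) (f · g))) τ ⟨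
    ∃[ S ∩ X ] (∃[ S′ ∩ X ] (R[ pr , S ∩ Y ++ S′ ∩ Y ] (f · g))) τ
      ≡⟨ projectAll-++ maxOp (S ∩ X) (S′ ∩ X) _ τ ⟨
    ∃[ S ∩ X ++ S′ ∩ X ] (R[ pr , S ∩ Y ++ S′ ∩ Y ] (f · g)) τ
      ≡⟨ ∃R-cong (f · g) (∩-++ S S′ X) (∩-++ S S′ Y) τ ⟨
    gradedProject (S ++ S′) (f · g) τ ∎
    where
    ∩⁺ : ∀ {P : Pred Var 0ℓ} {S Z} → All P S → All P (S ∩ Z)
    ∩⁺ {Z = Z} = filter⁺ (_∈? Z)
    maxHom : ∀ A → All (IsPosHomogeneous ∘ maxOp) A
    maxHom A = All.tabulate (λ _ → ⊔-isPosHomogeneous)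
    expectHom : ∀ A → All (IsPosHomogeneous ∘ expectOp pr) (A ∩ Y)
    expectHom A = All.map (λ {y} y∈Y → convex-isPosHomogeneous (proj₁ (prob y y∈Y))
                                                                (proj₂ (prob y y∈Y)))
                          (all-filter (_∈? Y) A)

VarOfClauses : ∀ {m} → CNF m → List (Fin m) → Pred Var 0ℓ
VarOfClauses φ L x = Any (λ i → x ∈ clauseVars (φ i)) L

⟦⟧-dependsOnlyOn : ∀ c → DependsOnlyOn (_∈ clauseVars c) ⟦ c ⟧
⟦⟧-dependsOnlyOn c τ τ′ agree =
  cong (λ b → if b then 1ℚ else 0ℚ) (cong or (map-cong-local (All.tabulate litSat-agree)))
  where
  litSat-agree : ∀ {l} → l ∈ c → litSat τ l ≡ litSat τ′ l
  litSat-agree {x , b} l∈c =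
    cong (λ t → if t then b else (if b then false else true)) (agree x (∈-map⁺ proj₁ l∈c))

⟦⟧-nonNeg : ∀ c → NonNegative ⟦ c ⟧
⟦⟧-nonNeg c τ with any (litSat τ) c
... | true  = ℚ.nonNegative⁻¹ 1ℚ
... | false = ℚ.≤-refl

module _ {m} (φ : CNF m) where

  prodClauses-dependsOnlyOn : ∀ L → DependsOnlyOn (VarOfClauses φ L) (prodClauses φ L)
  prodClauses-dependsOnlyOn []      τ τ′ agree = refl
  prodClauses-dependsOnlyOn (i ∷ L) τ τ′ agree =
    cong₂ _*_ (⟦⟧-dependsOnlyOn (φ i) τ τ′ (λ y → agree y ∘ here))
              (prodClauses-dependsOnlyOn L τ τ′ (λ y → agree y ∘ there))

  prodClauses-nonNeg : ∀ L → NonNegative (prodClauses φ L)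
  prodClauses-nonNeg []      τ = ℚ.nonNegative⁻¹ 1ℚ
  prodClauses-nonNeg (i ∷ L) τ = *-nonNeg (⟦⟧-nonNeg (φ i) τ) (prodClauses-nonNeg L τ)

  prodClauses-++ : ∀ L L′ → prodClauses φ (L ++ L′) ≗ prodClauses φ L · prodClauses φ L′
  prodClauses-++ []      L′ τ = sym (ℚ.*-identityˡ _)
  prodClauses-++ (i ∷ L) L′ τ =
    trans (cong (⟦ φ i ⟧ τ *_) (prodClauses-++ L L′ τ))
          (sym (ℚ.*-assoc (⟦ φ i ⟧ τ) (prodClauses φ L τ) (prodClauses φ L′ τ)))

  OccursOnlyIn : List Var → List (Fin m) → Set
  OccursOnlyIn S L = ∀ {x i} → x ∈ S → x ∈ clauseVars (φ i) → i ∈ L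

  occursOnlyIn-disjoint : ∀ {S L L′} → OccursOnlyIn S L → Disjoint L L′ →
                          All (∁ (VarOfClauses φ L′)) S
  occursOnlyIn-disjoint only L#L′ = All.tabulate λ x∈S x∈L′ →
    let i , i∈L′ , x∈φi = find x∈L′ in L#L′ (only x∈S x∈φi , i∈L′)

module _ {A : Set} where

  Unique-++⁻ˡ : ∀ (xs : List A) {ys} → Unique (xs ++ ys) → Unique xs
  Unique-++⁻ˡ []       _           = []
  Unique-++⁻ˡ (x ∷ xs) (x∉ ∷ xs!) = ++⁻ˡ xs x∉ ∷ Unique-++⁻ˡ xs xs!

  Unique-++⁻ʳ : ∀ (xs : List A) {ys} → Unique (xs ++ ys) → Unique ys
  Unique-++⁻ʳ []       ys!         = ys!
  Unique-++⁻ʳ (x ∷ xs) (_ ∷ xs!) = Unique-++⁻ʳ xs xs!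

  Unique-++⇒Disjoint : ∀ (xs : List A) {ys} → Unique (xs ++ ys) → Disjoint xs ys
  Unique-++⇒Disjoint (x ∷ xs) (x∉ ∷ _)   (here refl , v∈ys)  = All.lookup (++⁻ʳ xs x∉) v∈ys refl
  Unique-++⇒Disjoint (x ∷ xs) (_ ∷ xs!) (there v∈xs , v∈ys) =
    Unique-++⇒Disjoint xs xs! (v∈xs , v∈ys)

module _ {m : ℕ} where

  mutual
    ⊑-trans : {s t u : Tree m} → s ⊑ t → t ⊑ u → s ⊑ u
    ⊑-trans s⊑t here          = s⊑t
    ⊑-trans s⊑t (there t⊑cs) = there (⊑-trans-Any s⊑t t⊑cs)

    ⊑-trans-Any : {s t : Tree m} {cs : List (Tree m)} →
                  s ⊑ t → Any (t ⊑_) cs → Any (s ⊑_) cs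
    ⊑-trans-Any s⊑t (here t⊑c)    = here (⊑-trans s⊑t t⊑c)
    ⊑-trans-Any s⊑t (there t⊑cs) = there (⊑-trans-Any s⊑t t⊑cs)

  children-⊑ : ∀ {g π} (cs : List (Tree m)) → All (_⊑ node g π cs) cs
  children-⊑ cs = All.tabulate (λ c∈cs → there (Any.map (λ { refl → here }) c∈cs))

  mutual
    ⊑-leaves : {s t : Tree m} {i : Fin m} → s ⊑ t → i ∈ leaves s → i ∈ leaves t
    ⊑-leaves here          i∈s = i∈s
    ⊑-leaves (there s⊑cs) i∈s = ⊑-leavesL s⊑cs i∈s

    ⊑-leavesL : {s : Tree m} {cs : List (Tree m)} {i : Fin m} →
                Any (s ⊑_) cs → i ∈ leaves s → i ∈ leavesL cs
    ⊑-leavesL (here s⊑c)                 i∈s = ∈-++⁺ˡ (⊑-leaves s⊑c i∈s)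
    ⊑-leavesL {cs = c ∷ _} (there s⊑cs) i∈s = ∈-++⁺ʳ (leaves c) (⊑-leavesL s⊑cs i∈s)

  mutual
    ⊑-Unique : {s t : Tree m} → s ⊑ t → Unique (leaves t) → Unique (leaves s)
    ⊑-Unique here          t! = t!
    ⊑-Unique (there s⊑cs) t! = ⊑-UniqueL s⊑cs t!

    ⊑-UniqueL : {s : Tree m} {cs : List (Tree m)} →
                Any (s ⊑_) cs → Unique (leavesL cs) → Unique (leaves s)
    ⊑-UniqueL {cs = c ∷ _} (here s⊑c)    cs! = ⊑-Unique s⊑c (Unique-++⁻ˡ (leaves c) cs!)
    ⊑-UniqueL {cs = c ∷ _} (there s⊑cs) cs! = ⊑-UniqueL s⊑cs (Unique-++⁻ʳ (leaves c) cs!)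

  record ProjectedIn (x : Var) (Position : Tree m → Set) : Set where
    constructor projected
    field
      {grade} : Grade
      {π}     : List Var
      {cs}    : List (Tree m)
      position : Position (node grade π cs)
      x∈π      : x ∈ π

  reposition : ∀ {x} {P Q : Tree m → Set} →
               (∀ {w} → P w → Q w) → ProjectedIn x P → ProjectedIn x Q
  reposition f (projected p x∈π) = projected (f p) x∈π

  mutual
    ∈Πset⁻ : ∀ {x} v → x ∈ Πset v → ProjectedIn x (_⊑ v)
    ∈Πset⁻ (node g π cs) x∈Π with ∈-++⁻ π x∈Π
    ... | inj₁ x∈π  = projected here x∈π
    ... | inj₂ x∈Π′ = reposition there (∈ΠsetL⁻ cs x∈Π′)

    ∈ΠsetL⁻ : ∀ {x} cs → x ∈ ΠsetL cs → ProjectedIn x (λ w → Any (w ⊑_) cs)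
    ∈ΠsetL⁻ (c ∷ cs) x∈Π with ∈-++⁻ (Πset c) x∈Π
    ... | inj₁ x∈Πc = reposition here (∈Πset⁻ c x∈Πc)
    ... | inj₂ x∈Π′ = reposition there (∈ΠsetL⁻ cs x∈Π′)

module Valuation {m} (φ : CNF m) (X Y : List Var) (T : Tree m) (pr : Var → ℚ)
                 (partition : IsVarPartition φ X Y) (pjt : IsProjectJoinTree φ T)
                 (graded : IsGraded X Y T) (prob : IsProbMap Y pr) where

  open IsProjectJoinTree pjt using (γ-bij; π-scope)
  open IsGraded graded
  open GradedProjection X Y pr

  X∩Y=∅ : ∀ {x} → x ∈ X → x ∉ Y
  X∩Y=∅ {x} = proj₂ (proj₂ (partition x))

  unique-leaves : ∀ {v} → v ⊑ T → Unique (leaves v)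
  unique-leaves v⊑T =
    ⊑-Unique v⊑T (Unique-resp-↭ (setoid (Fin m)) (↭⇒↭ₛ (↭-sym γ-bij)) (allFin⁺ m))

  children-⊑T : ∀ {g π cs} → node g π cs ⊑ T → All (_⊑ T) cs
  children-⊑T {cs = cs} v⊑T = All.map (λ c⊑v → ⊑-trans c⊑v v⊑T) (children-⊑ cs)

  Πset-occursOnlyIn : ∀ {v} → v ⊑ T → OccursOnlyIn φ (Πset v) (leaves v)
  Πset-occursOnlyIn {v} v⊑T x∈Π x∈φi with ∈Πset⁻ v x∈Π
  ... | projected w⊑v x∈π = ⊑-leaves w⊑v (π-scope _ _ _ (⊑-trans w⊑v v⊑T) _ x∈π _ x∈φi)

  ΠsetL-occursOnlyIn : ∀ {cs} → All (_⊑ T) cs → OccursOnlyIn φ (ΠsetL cs) (leavesL cs)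
  ΠsetL-occursOnlyIn {c ∷ _} (c⊑T ∷ cs⊑T) x∈Π x∈φi with ∈-++⁻ (Πset c) x∈Π
  ... | inj₁ x∈Πc = ∈-++⁺ˡ (Πset-occursOnlyIn c⊑T x∈Πc x∈φi)
  ... | inj₂ x∈Π′ = ∈-++⁺ʳ (leaves c) (ΠsetL-occursOnlyIn cs⊑T x∈Π′ x∈φi)

  Y-node-Πset⊆Y : ∀ {π cs} → node gY π cs ⊑ T → All (_∈ Y) (Πset (node gY π cs))
  Y-node-Πset⊆Y v⊑T = All.tabulate (∈Y ∘ ∈Πset⁻ _)
    where
    ∈Y : ∀ {x} → ProjectedIn x (_⊑ _) → x ∈ Y
    ∈Y (projected {gX} w⊑v _)   = ⊥-elim (X-not-below-Y _ _ _ _ v⊑T w⊑v)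
    ∈Y (projected {gY} w⊑v x∈π) = π⊆grade gY _ _ (⊑-trans w⊑v v⊑T) _ x∈π

  mutual
    val≗gradedProject : ∀ v → v ⊑ T → val φ pr v ≗ gradedProject (Πset v) (prodClauses φ (leaves v))
    val≗gradedProject (leaf i)       _   τ = sym (ℚ.*-identityʳ _)
    val≗gradedProject (node gX π cs) v⊑T τ =
      trans (projectAll-cong maxOp π (children≗ v⊑T) τ)
            (∃-gradedProject _ π⊆X (All.map X∩Y=∅ π⊆X) τ)
      where
      π⊆X : All (_∈ X) π
      π⊆X = All.tabulate (π⊆grade gX π cs v⊑T _)
    val≗gradedProject (node gY π cs) v⊑T τ =
      trans (projectAll-cong (expectOp pr) π (children≗ v⊑T) τ)
            (R-gradedProject {π} {ΠsetL cs} _ (All.map (λ x∈Y x∈X → X∩Y=∅ x∈X x∈Y) Π⊆Y) Π⊆Y τ)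
      where
      Π⊆Y : All (_∈ Y) (π ++ ΠsetL cs)
      Π⊆Y = Y-node-Πset⊆Y v⊑T

    children≗ : ∀ {g π cs} → node g π cs ⊑ T →
                valL φ pr cs ≗ gradedProject (ΠsetL cs) (prodClauses φ (leavesL cs))
    children≗ {cs = cs} v⊑T = valL≗gradedProject cs (children-⊑T v⊑T) (unique-leaves v⊑T)

    valL≗gradedProject : ∀ cs → All (_⊑ T) cs → Unique (leavesL cs) →
                         valL φ pr cs ≗ gradedProject (ΠsetL cs) (prodClauses φ (leavesL cs))
    valL≗gradedProject []       _            _     τ = refl
    valL≗gradedProject (c ∷ cs) (c⊑T ∷ cs⊑T) c∷cs! τ = begin
      val φ pr c τ * valL φ pr cs τ
        ≡⟨ cong₂ _*_ (val≗gradedProject c c⊑T τ)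
                     (valL≗gradedProject cs cs⊑T (Unique-++⁻ʳ (leaves c) c∷cs!) τ) ⟩
      (gradedProject (Πset c) (prodClauses φ (leaves c)) ·
       gradedProject (ΠsetL cs) (prodClauses φ (leavesL cs))) τ
        ≡⟨ gradedProject-· prob
             (occursOnlyIn-disjoint φ (Πset-occursOnlyIn c⊑T) c#cs)
             (occursOnlyIn-disjoint φ (ΠsetL-occursOnlyIn cs⊑T) (Disjoint.sym c#cs))
             (prodClauses-dependsOnlyOn φ (leaves c)) (prodClauses-dependsOnlyOn φ (leavesL cs))
             (prodClauses-nonNeg φ (leaves c)) (prodClauses-nonNeg φ (leavesL cs)) τ ⟩
      gradedProject (Πset c ++ ΠsetL cs) (prodClauses φ (leaves c) · prodClauses φ (leavesL cs)) τ
        ≡⟨ gradedProject-cong (Πset c ++ ΠsetL cs) (prodClauses-++ φ (leaves c) (leavesL cs)) τ ⟨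
      gradedProject (ΠsetL (c ∷ cs)) (prodClauses φ (leavesL (c ∷ cs))) τ ∎
      where
      open ≡-Reasoning
      c#cs : Disjoint (leaves c) (leavesL cs)
      c#cs = Unique-++⇒Disjoint (leaves c) c∷cs!

lemma3 : ∀ {m} (φ : CNF m) (X Y : List Var) (T : Tree m) (pr : Var → ℚ) →
    IsVarPartition φ X Y → IsProjectJoinTree φ T → IsGraded X Y T →
    IsProbMap Y pr →
    ∀ v → v ⊑ T → ∀ τ →
    val φ pr v τ ≡ ∃[ Πset v ∩ X ] (R[ pr , Πset v ∩ Y ] (prodClauses φ (leaves v))) τ
lemma3 φ X Y T pr partition pjt graded prob =
  Valuation.val≗gradedProject φ X Y T pr partition pjt graded prob
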